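{- Let $O_B=\lambda n(n\,\lambda f(f\,T)\,\lambda f(f\,F))$. Then (1) $\vdash_{\mathcal{F}}O_B:B^*\to\neg\neg B$; (2) for every $\epsilon\in\{T,F\}$ and every $\lambda$-term $\theta_\epsilon\simeq_\beta\epsilon$, $(O_B\,\theta_\epsilon\,f)\succ(f\,\epsilon)$, where $f$ is a fresh variable.
   Context: $T=\lambda x\lambda y\,x$, $F=\lambda x\lambda y\,y$, $B=\forall X(X\to X\to X)$. $\simeq_\beta$ is $\beta$-equivalence; head reduction contracts the head redex $(\lambda x\,u)\,v$ of a term $\lambda x_1\dots\lambda x_n((\lambda x\,u)\,v\,v_1\dots v_m)$, and $u\succ v$ means $v$ is obtained from $u$ by finitely many (possibly zero) head reduction steps. System $\mathcal{F}$: types from type variables and $\perp$ with $\to$ and $\forall X$, usual typing rules; $\neg A=A\to\perp$. Gödel translation: $\perp^*=\perp$, $X^*=\neg X$, $(A\to C)^*=A^*\to C^*$, $(\forall XA)^*=\forall XA^*$. -}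

module Defs where

open import Data.Nat using (ℕ; zero; suc)
open import Data.List using (List; []; _∷_; map)
open import Relation.Binary.Construct.Closure.ReflexiveTransitive using (Star)
open import Relation.Binary.Construct.Closure.Equivalence using (EqClosure)

infixr 7 _⇒_

data Ty : Set where
  tv  : ℕ → Ty
  `⊥  : Ty
  _⇒_ : Ty → Ty → Ty
  `∀  : Ty → Ty        -- `∀ A binds type variable 0 in A

Ren : Set
Ren = ℕ → ℕ

liftR : Ren → Ren
liftR ρ zero    = zero
liftR ρ (suc x) = suc (ρ x)

tren : Ren → Ty → Ty
tren ρ (tv x)  = tv (ρ x)
tren ρ `⊥      = `⊥
tren ρ (A ⇒ C) = tren ρ A ⇒ tren ρ C
tren ρ (`∀ A)  = `∀ (tren (liftR ρ) A)

tliftS : (ℕ → Ty) → (ℕ → Ty)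
tliftS σ zero    = tv zero
tliftS σ (suc x) = tren suc (σ x)

tsub : (ℕ → Ty) → Ty → Ty
tsub σ (tv x)  = σ x
tsub σ `⊥      = `⊥
tsub σ (A ⇒ C) = tsub σ A ⇒ tsub σ C
tsub σ (`∀ A)  = `∀ (tsub (tliftS σ) A)

tcons : Ty → (ℕ → Ty) → (ℕ → Ty)
tcons B σ zero    = B
tcons B σ (suc x) = σ x

_[_]ᵗ : Ty → Ty → Ty
A [ B ]ᵗ = tsub (tcons B tv) A

¬ᵗ : Ty → Ty
¬ᵗ A = A ⇒ `⊥

Bool𝔽 : Ty
Bool𝔽 = `∀ (tv 0 ⇒ tv 0 ⇒ tv 0)

_* : Ty → Ty
tv x *    = ¬ᵗ (tv x)
`⊥ *      = `⊥
(A ⇒ C) * = (A *) ⇒ (C *)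
`∀ A *    = `∀ (A *)

data Tm : Set where
  var : ℕ → Tm
  lam : Tm → Tm
  app : Tm → Tm → Tm

ren : Ren → Tm → Tm
ren ρ (var x)   = var (ρ x)
ren ρ (lam t)   = lam (ren (liftR ρ) t)
ren ρ (app t u) = app (ren ρ t) (ren ρ u)

liftS : (ℕ → Tm) → (ℕ → Tm)
liftS σ zero    = var zero
liftS σ (suc x) = ren suc (σ x)

sub : (ℕ → Tm) → Tm → Tm
sub σ (var x)   = σ x
sub σ (lam t)   = lam (sub (liftS σ) t)
sub σ (app t u) = app (sub σ t) (sub σ u)

cons : Tm → (ℕ → Tm) → (ℕ → Tm)
cons v σ zero    = v
cons v σ (suc x) = σ x

_[_] : Tm → Tm → Tm
u [ v ] = sub (cons v var) u

data _∈fv_ : ℕ → Tm → Set where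
  fv-var  : ∀ {k} → k ∈fv var k
  fv-lam  : ∀ {k t} → suc k ∈fv t → k ∈fv lam t
  fv-appˡ : ∀ {k t u} → k ∈fv t → k ∈fv app t u
  fv-appʳ : ∀ {k t u} → k ∈fv u → k ∈fv app t u

data _→β_ : Tm → Tm → Set where
  β     : ∀ {u v} → app (lam u) v →β (u [ v ])
  ξ-lam : ∀ {t t'} → t →β t' → lam t →β lam t'
  ξ-appˡ : ∀ {t t' u} → t →β t' → app t u →β app t' u
  ξ-appʳ : ∀ {t u u'} → u →β u' → app t u →β app t u'

_≃β_ : Tm → Tm → Set
_≃β_ = EqClosure _→β_

-- one head-reduction step: contracts the head redex (λx u) v of
-- λx₁…λxₙ((λx u) v v₁…vₘ)
data _→h_ : Tm → Tm → Set where
  h-β   : ∀ {u v} → app (lam u) v →h (u [ v ])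
  h-lam : ∀ {t t'} → t →h t' → lam t →h lam t'
  h-app : ∀ {t₁ t₂ t' s} → app t₁ t₂ →h t' → app (app t₁ t₂) s →h app t' s

_≻_ : Tm → Tm → Set
_≻_ = Star _→h_

Ctx : Set
Ctx = List Ty

data _∋_∶_ : Ctx → ℕ → Ty → Set where
  here  : ∀ {Γ A} → (A ∷ Γ) ∋ zero ∶ A
  there : ∀ {Γ A B x} → Γ ∋ x ∶ A → (B ∷ Γ) ∋ suc x ∶ A

data _⊢_∶_ : Ctx → Tm → Ty → Set where
  ⊢var : ∀ {Γ x A} → Γ ∋ x ∶ A → Γ ⊢ var x ∶ A
  ⊢lam : ∀ {Γ t A C} → (A ∷ Γ) ⊢ t ∶ C → Γ ⊢ lam t ∶ (A ⇒ C)
  ⊢app : ∀ {Γ t u A C} → Γ ⊢ t ∶ (A ⇒ C) → Γ ⊢ u ∶ A → Γ ⊢ app t u ∶ C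
  -- ∀-introduction: X not free in Γ is expressed by shifting Γ
  ⊢gen  : ∀ {Γ t A} → map (tren suc) Γ ⊢ t ∶ A → Γ ⊢ t ∶ `∀ A
  ⊢inst : ∀ {Γ t A B} → Γ ⊢ t ∶ `∀ A → Γ ⊢ t ∶ (A [ B ]ᵗ)

T F : Tm
T = lam (lam (var 1))
F = lam (lam (var 0))

O_B : Tm
O_B = lam (app (app (var 0) (lam (app (var 0) T))) (lam (app (var 0) F)))

-- O_B θ f head-reduces to θ (λf.f T) (λf.f F) f, so everything rests on showing that
-- θ ≃β ε implies θ ≻ ε for ε ∈ {T, F}.  Confluence (Takahashi's parallel reduction and
-- complete developments) turns θ ≃β ε into θ ⇛* ε, ε being normal.  Standardization then
-- turns θ ⇛* ε into head reduction: every parallel step factors as head steps followed by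
-- an internal parallel step, internal steps can be postponed past head steps, and nothing
-- but ε itself reduces internally to ε.  The typing part instantiates the ∀ of B* at ¬B.
module Submission where

open import Defs
open import Data.Nat using (ℕ; zero; suc)
open import Data.List using ([])
open import Data.Product using (_×_; _,_; ∃)
open import Data.Sum using (_⊎_; inj₁; inj₂)
open import Data.Empty using (⊥-elim)
open import Relation.Nullary using (¬_)
open import Relation.Binary.PropositionalEquality
  using (_≡_; _≢_; refl; sym; trans; cong; cong₂; subst)
open import Relation.Binary.Construct.Closure.ReflexiveTransitive
  using (Star; _◅_; _◅◅_) renaming (ε to ◅-refl)
open import Relation.Binary.Construct.Closure.Symmetric using (fwd; bwd)

ren-cong : ∀ {ρ ρ'} → (∀ x → ρ x ≡ ρ' x) → ∀ t → ren ρ t ≡ ren ρ' t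
ren-cong e (var x)   = cong var (e x)
ren-cong e (lam t)   = cong lam (ren-cong liftR-cong t)
  where
  liftR-cong : ∀ x → liftR _ x ≡ liftR _ x
  liftR-cong zero    = refl
  liftR-cong (suc x) = cong suc (e x)
ren-cong e (app t u) = cong₂ app (ren-cong e t) (ren-cong e u)

liftS-cong : ∀ {σ σ'} → (∀ x → σ x ≡ σ' x) → ∀ x → liftS σ x ≡ liftS σ' x
liftS-cong e zero    = refl
liftS-cong e (suc x) = cong (ren suc) (e x)

sub-cong : ∀ {σ σ'} → (∀ x → σ x ≡ σ' x) → ∀ t → sub σ t ≡ sub σ' t
sub-cong e (var x)   = e x
sub-cong e (lam t)   = cong lam (sub-cong (liftS-cong e) t)
sub-cong e (app t u) = cong₂ app (sub-cong e t) (sub-cong e u)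

ren-ren : ∀ ρ ρ' t → ren ρ (ren ρ' t) ≡ ren (λ x → ρ (ρ' x)) t
ren-ren ρ ρ' (var x)   = refl
ren-ren ρ ρ' (lam t)   =
  cong lam (trans (ren-ren (liftR ρ) (liftR ρ') t) (ren-cong liftR-∘ t))
  where
  liftR-∘ : ∀ x → liftR ρ (liftR ρ' x) ≡ liftR (λ x → ρ (ρ' x)) x
  liftR-∘ zero    = refl
  liftR-∘ (suc x) = refl
ren-ren ρ ρ' (app t u) = cong₂ app (ren-ren ρ ρ' t) (ren-ren ρ ρ' u)

ren-sub : ∀ ρ σ t → ren ρ (sub σ t) ≡ sub (λ x → ren ρ (σ x)) t
ren-sub ρ σ (var x)   = refl
ren-sub ρ σ (lam t)   =
  cong lam (trans (ren-sub (liftR ρ) (liftS σ) t) (sub-cong ren-liftS t))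
  where
  ren-liftS : ∀ x → ren (liftR ρ) (liftS σ x) ≡ liftS (λ x → ren ρ (σ x)) x
  ren-liftS zero    = refl
  ren-liftS (suc x) = trans (ren-ren (liftR ρ) suc (σ x)) (sym (ren-ren suc ρ (σ x)))
ren-sub ρ σ (app t u) = cong₂ app (ren-sub ρ σ t) (ren-sub ρ σ u)

sub-ren : ∀ σ ρ t → sub σ (ren ρ t) ≡ sub (λ x → σ (ρ x)) t
sub-ren σ ρ (var x)   = refl
sub-ren σ ρ (lam t)   =
  cong lam (trans (sub-ren (liftS σ) (liftR ρ) t) (sub-cong liftS-liftR t))
  where
  liftS-liftR : ∀ x → liftS σ (liftR ρ x) ≡ liftS (λ x → σ (ρ x)) x
  liftS-liftR zero    = refl
  liftS-liftR (suc x) = refl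
sub-ren σ ρ (app t u) = cong₂ app (sub-ren σ ρ t) (sub-ren σ ρ u)

sub-sub : ∀ σ τ t → sub σ (sub τ t) ≡ sub (λ x → sub σ (τ x)) t
sub-sub σ τ (var x)   = refl
sub-sub σ τ (lam t)   =
  cong lam (trans (sub-sub (liftS σ) (liftS τ) t) (sub-cong sub-liftS t))
  where
  sub-liftS : ∀ x → sub (liftS σ) (liftS τ x) ≡ liftS (λ x → sub σ (τ x)) x
  sub-liftS zero    = refl
  sub-liftS (suc x) = trans (sub-ren (liftS σ) suc (τ x)) (sym (ren-sub suc σ (τ x)))
sub-sub σ τ (app t u) = cong₂ app (sub-sub σ τ t) (sub-sub σ τ u)

sub-id : ∀ t → sub var t ≡ t
sub-id (var x)   = refl
sub-id (lam t)   = cong lam (trans (sub-cong liftS-var t) (sub-id t))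
  where
  liftS-var : ∀ x → liftS var x ≡ var x
  liftS-var zero    = refl
  liftS-var (suc x) = refl
sub-id (app t u) = cong₂ app (sub-id t) (sub-id u)

sub-[] : ∀ σ u v → sub σ (u [ v ]) ≡ sub (liftS σ) u [ sub σ v ]
sub-[] σ u v =
  trans (sub-sub σ (cons v var) u)
        (trans (sub-cong pointwise u) (sym (sub-sub (cons (sub σ v) var) (liftS σ) u)))
  where
  pointwise : ∀ x → sub σ (cons v var x) ≡ sub (cons (sub σ v) var) (liftS σ x)
  pointwise zero    = refl
  pointwise (suc x) = sym (trans (sub-ren (cons (sub σ v) var) suc (σ x)) (sub-id (σ x)))

ren-[] : ∀ ρ u v → ren ρ (u [ v ]) ≡ ren (liftR ρ) u [ ren ρ v ]
ren-[] ρ u v =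
  trans (ren-sub ρ (cons v var) u)
        (trans (sub-cong pointwise u) (sym (sub-ren (cons (ren ρ v) var) (liftR ρ) u)))
  where
  pointwise : ∀ x → ren ρ (cons v var x) ≡ cons (ren ρ v) var (liftR ρ x)
  pointwise zero    = refl
  pointwise (suc x) = refl

-- Head reduction

→h-sub : ∀ σ {t t'} → t →h t' → sub σ t →h sub σ t'
→h-sub σ (h-β {u} {v}) = subst (sub σ (app (lam u) v) →h_) (sym (sub-[] σ u v)) h-β
→h-sub σ (h-lam p)     = h-lam (→h-sub (liftS σ) p)
→h-sub σ (h-app p)     = h-app (→h-sub σ p)

≻-sub : ∀ σ {t t'} → t ≻ t' → sub σ t ≻ sub σ t'
≻-sub σ ◅-refl  = ◅-refl
≻-sub σ (p ◅ r) = →h-sub σ p ◅ ≻-sub σ r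

→h-ren : ∀ ρ {t t'} → t →h t' → ren ρ t →h ren ρ t'
→h-ren ρ (h-β {u} {v}) = subst (ren ρ (app (lam u) v) →h_) (sym (ren-[] ρ u v)) h-β
→h-ren ρ (h-lam p)     = h-lam (→h-ren (liftR ρ) p)
→h-ren ρ (h-app p)     = h-app (→h-ren ρ p)

≻-ren : ∀ ρ {t t'} → t ≻ t' → ren ρ t ≻ ren ρ t'
≻-ren ρ ◅-refl  = ◅-refl
≻-ren ρ (p ◅ r) = →h-ren ρ p ◅ ≻-ren ρ r

≻-lam : ∀ {t t'} → t ≻ t' → lam t ≻ lam t'
≻-lam ◅-refl  = ◅-refl
≻-lam (p ◅ r) = h-lam p ◅ ≻-lam r

≻-lam⁻¹ : ∀ {t t'} → lam t ≻ lam t' → t ≻ t'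
≻-lam⁻¹ ◅-refl        = ◅-refl
≻-lam⁻¹ (h-lam p ◅ r) = p ◅ ≻-lam⁻¹ r

lam-≻ : ∀ {t u} → lam t ≻ u → ∃ λ t' → u ≡ lam t'
lam-≻ ◅-refl        = _ , refl
lam-≻ (h-lam _ ◅ r) = lam-≻ r

≻-appˡ : ∀ {t u} w → (∀ {b} → u ≢ lam b) → t ≻ u → app t w ≻ app u w
≻-appˡ w u≢lam ◅-refl        = ◅-refl
≻-appˡ w u≢lam (h-β ◅ r)     = h-app h-β ◅ ≻-appˡ w u≢lam r
≻-appˡ w u≢lam (h-app p ◅ r) = h-app (h-app p) ◅ ≻-appˡ w u≢lam r
≻-appˡ w u≢lam (h-lam p ◅ r) with lam-≻ r
... | _ , u≡lam = ⊥-elim (u≢lam u≡lam)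

≻-lam-appˡ : ∀ {t k} w → t ≻ lam k → ∃ λ k₀ → (app t w ≻ app (lam k₀) w) × (k₀ ≻ k)
≻-lam-appˡ w ◅-refl = _ , ◅-refl , ◅-refl
≻-lam-appˡ w (h-β ◅ r) with ≻-lam-appˡ w r
... | k₀ , t↠ , k₀↠ = k₀ , h-app h-β ◅ t↠ , k₀↠
≻-lam-appˡ w (h-app p ◅ r) with ≻-lam-appˡ w r
... | k₀ , t↠ , k₀↠ = k₀ , h-app (h-app p) ◅ t↠ , k₀↠
≻-lam-appˡ w (h-lam p ◅ r) = _ , ◅-refl , p ◅ ≻-lam⁻¹ r

≻-β : ∀ {t u} s → t ≻ lam u → app t s ≻ (u [ s ])
≻-β s ◅-refl        = h-β ◅ ◅-refl
≻-β s (h-β ◅ r)     = h-app h-β ◅ ≻-β s r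
≻-β s (h-app p ◅ r) = h-app (h-app p) ◅ ≻-β s r
≻-β s (h-lam p ◅ r) = h-β ◅ ≻-sub (cons s var) (p ◅ ≻-lam⁻¹ r)

-- Parallel reduction and confluence

infix 4 _⇛_ _⇛*_

data _⇛_ : Tm → Tm → Set where
  ⇛-var : ∀ {x} → var x ⇛ var x
  ⇛-lam : ∀ {t t'} → t ⇛ t' → lam t ⇛ lam t'
  ⇛-app : ∀ {t t' u u'} → t ⇛ t' → u ⇛ u' → app t u ⇛ app t' u'
  ⇛-β   : ∀ {u u' v v'} → u ⇛ u' → v ⇛ v' → app (lam u) v ⇛ (u' [ v' ])

_⇛*_ : Tm → Tm → Set
_⇛*_ = Star _⇛_

ParNormal : Tm → Set
ParNormal e = ∀ {w} → e ⇛ w → w ≡ e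

⇛-refl : ∀ t → t ⇛ t
⇛-refl (var x)   = ⇛-var
⇛-refl (lam t)   = ⇛-lam (⇛-refl t)
⇛-refl (app t u) = ⇛-app (⇛-refl t) (⇛-refl u)

→β⇒⇛ : ∀ {t s} → t →β s → t ⇛ s
→β⇒⇛ (β {u} {v})          = ⇛-β (⇛-refl u) (⇛-refl v)
→β⇒⇛ (ξ-lam p)            = ⇛-lam (→β⇒⇛ p)
→β⇒⇛ (ξ-appˡ {u = u} p)   = ⇛-app (→β⇒⇛ p) (⇛-refl u)
→β⇒⇛ (ξ-appʳ {t = t} p)   = ⇛-app (⇛-refl t) (→β⇒⇛ p)

⇛-ren : ∀ ρ {t t'} → t ⇛ t' → ren ρ t ⇛ ren ρ t'
⇛-ren ρ ⇛-var       = ⇛-var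
⇛-ren ρ (⇛-lam p)   = ⇛-lam (⇛-ren (liftR ρ) p)
⇛-ren ρ (⇛-app p q) = ⇛-app (⇛-ren ρ p) (⇛-ren ρ q)
⇛-ren ρ (⇛-β {u} {u'} {v} {v'} p q) =
  subst (ren ρ (app (lam u) v) ⇛_) (sym (ren-[] ρ u' v'))
        (⇛-β (⇛-ren (liftR ρ) p) (⇛-ren ρ q))

⇛-liftS : ∀ {σ σ'} → (∀ x → σ x ⇛ σ' x) → ∀ x → liftS σ x ⇛ liftS σ' x
⇛-liftS σ⇛ zero    = ⇛-var
⇛-liftS σ⇛ (suc x) = ⇛-ren suc (σ⇛ x)

⇛-sub : ∀ {σ σ'} → (∀ x → σ x ⇛ σ' x) → ∀ {t t'} → t ⇛ t' → sub σ t ⇛ sub σ' t'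
⇛-sub σ⇛ ⇛-var       = σ⇛ _
⇛-sub σ⇛ (⇛-lam p)   = ⇛-lam (⇛-sub (⇛-liftS σ⇛) p)
⇛-sub σ⇛ (⇛-app p q) = ⇛-app (⇛-sub σ⇛ p) (⇛-sub σ⇛ q)
⇛-sub {σ} {σ'} σ⇛ (⇛-β {u} {u'} {v} {v'} p q) =
  subst (sub σ (app (lam u) v) ⇛_) (sym (sub-[] σ' u' v'))
        (⇛-β (⇛-sub (⇛-liftS σ⇛) p) (⇛-sub σ⇛ q))

⇛-cons : ∀ {v v'} → v ⇛ v' → ∀ x → cons v var x ⇛ cons v' var x
⇛-cons q zero    = q
⇛-cons q (suc x) = ⇛-var

complete : Tm → Tm
complete (var x)           = var x
complete (lam t)           = lam (complete t)
complete (app (var x) v)   = app (var x) (complete v)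
complete (app (lam u) v)   = complete u [ complete v ]
complete (app (app a b) v) = app (complete (app a b)) (complete v)

⇛-complete : ∀ {t s} → t ⇛ s → s ⇛ complete t
⇛-complete ⇛-var                         = ⇛-var
⇛-complete (⇛-lam p)                     = ⇛-lam (⇛-complete p)
⇛-complete (⇛-app {t = var _} ⇛-var q)   = ⇛-app ⇛-var (⇛-complete q)
⇛-complete (⇛-app {t = lam _} (⇛-lam p) q) = ⇛-β (⇛-complete p) (⇛-complete q)
⇛-complete (⇛-app {t = app _ _} p q)     = ⇛-app (⇛-complete p) (⇛-complete q)
⇛-complete (⇛-β p q)                     = ⇛-sub (⇛-cons (⇛-complete q)) (⇛-complete p)

⇛-strip : ∀ {t s₁ s₂} → t ⇛ s₁ → t ⇛* s₂ → ∃ λ w → (s₁ ⇛* w) × (s₂ ⇛ w)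
⇛-strip p ◅-refl = _ , ◅-refl , p
⇛-strip p (q ◅ r) with ⇛-strip (⇛-complete q) r
... | w , s₁⇛*w , s₂⇛w = w , ⇛-complete p ◅ s₁⇛*w , s₂⇛w

≃β⇒⇛* : ∀ {e θ} → ParNormal e → θ ≃β e → θ ⇛* e
≃β⇒⇛* e-normal ◅-refl      = ◅-refl
≃β⇒⇛* e-normal (fwd p ◅ r) = →β⇒⇛ p ◅ ≃β⇒⇛* e-normal r
≃β⇒⇛* e-normal (bwd p ◅ r) with ⇛-strip (→β⇒⇛ p) (≃β⇒⇛* e-normal r)
... | w , θ⇛*w , e⇛w = subst (Star _⇛_ _) (e-normal e⇛w) θ⇛*w

-- Standardization

-- t ⇛ₕ t' : head steps, then an internal parallel step ⇛ᵢ, which goes under the leading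
-- abstractions and then reduces a spine (⇛ₛ) without contracting its head redex.
infix 4 _⇛ₛ_ _⇛ᵢ_ _⇛ₕ_

mutual
  data _⇛ₛ_ : Tm → Tm → Set where
    ⇛ₛ-var   : ∀ {x} → var x ⇛ₛ var x
    ⇛ₛ-app   : ∀ {t t' w w'} → t ⇛ₛ t' → w ⇛ₕ w' → app t w ⇛ₛ app t' w'
    ⇛ₛ-redex : ∀ {u u' w w'} → u ⇛ₕ u' → w ⇛ₕ w' → app (lam u) w ⇛ₛ app (lam u') w'

  data _⇛ᵢ_ : Tm → Tm → Set where
    ⇛ᵢ-lam   : ∀ {t t'} → t ⇛ᵢ t' → lam t ⇛ᵢ lam t'
    ⇛ᵢ-spine : ∀ {t t'} → t ⇛ₛ t' → t ⇛ᵢ t'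

  data _⇛ₕ_ : Tm → Tm → Set where
    head-then-internal : ∀ {t u t'} → t ≻ u → u ⇛ᵢ t' → t ⇛ₕ t'

InternallyRigid : Tm → Set
InternallyRigid e = ∀ {t} → t ⇛ᵢ e → t ≡ e

⇛ₛ-source-not-lam : ∀ {t t'} → t ⇛ₛ t' → ∀ {b} → t ≢ lam b
⇛ₛ-source-not-lam ⇛ₛ-var         ()
⇛ₛ-source-not-lam (⇛ₛ-app _ _)   ()
⇛ₛ-source-not-lam (⇛ₛ-redex _ _) ()

⇛ₕ-var : ∀ {x} → var x ⇛ₕ var x
⇛ₕ-var = head-then-internal ◅-refl (⇛ᵢ-spine ⇛ₛ-var)

≻-⇛ₕ : ∀ {t u t'} → t ≻ u → u ⇛ₕ t' → t ⇛ₕ t'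
≻-⇛ₕ r (head-then-internal r' i) = head-then-internal (r ◅◅ r') i

⇛ₕ-lam : ∀ {t t'} → t ⇛ₕ t' → lam t ⇛ₕ lam t'
⇛ₕ-lam (head-then-internal r i) = head-then-internal (≻-lam r) (⇛ᵢ-lam i)

⇛ₕ-app : ∀ {t t' w w'} → t ⇛ₕ t' → w ⇛ₕ w' → app t w ⇛ₕ app t' w'
⇛ₕ-app {w = w} (head-then-internal r (⇛ᵢ-spine s)) q =
  head-then-internal (≻-appˡ w (⇛ₛ-source-not-lam s) r) (⇛ᵢ-spine (⇛ₛ-app s q))
⇛ₕ-app {w = w} (head-then-internal r (⇛ᵢ-lam i)) q with ≻-lam-appˡ w r
... | _ , t↠ , k₀↠ = head-then-internal t↠ (⇛ᵢ-spine (⇛ₛ-redex (head-then-internal k₀↠ i) q))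

mutual
  ⇛ₛ-ren : ∀ ρ {t t'} → t ⇛ₛ t' → ren ρ t ⇛ₛ ren ρ t'
  ⇛ₛ-ren ρ ⇛ₛ-var          = ⇛ₛ-var
  ⇛ₛ-ren ρ (⇛ₛ-app s w)    = ⇛ₛ-app (⇛ₛ-ren ρ s) (⇛ₕ-ren ρ w)
  ⇛ₛ-ren ρ (⇛ₛ-redex u w)  = ⇛ₛ-redex (⇛ₕ-ren (liftR ρ) u) (⇛ₕ-ren ρ w)

  ⇛ᵢ-ren : ∀ ρ {t t'} → t ⇛ᵢ t' → ren ρ t ⇛ᵢ ren ρ t'
  ⇛ᵢ-ren ρ (⇛ᵢ-lam i)   = ⇛ᵢ-lam (⇛ᵢ-ren (liftR ρ) i)
  ⇛ᵢ-ren ρ (⇛ᵢ-spine s) = ⇛ᵢ-spine (⇛ₛ-ren ρ s)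

  ⇛ₕ-ren : ∀ ρ {t t'} → t ⇛ₕ t' → ren ρ t ⇛ₕ ren ρ t'
  ⇛ₕ-ren ρ (head-then-internal r i) = head-then-internal (≻-ren ρ r) (⇛ᵢ-ren ρ i)

⇛ₕ-liftS : ∀ {σ σ'} → (∀ x → σ x ⇛ₕ σ' x) → ∀ x → liftS σ x ⇛ₕ liftS σ' x
⇛ₕ-liftS σ⇛ zero    = ⇛ₕ-var
⇛ₕ-liftS σ⇛ (suc x) = ⇛ₕ-ren suc (σ⇛ x)

⇛ₕ-cons : ∀ {v v'} → v ⇛ₕ v' → ∀ x → cons v var x ⇛ₕ cons v' var x
⇛ₕ-cons q zero    = q
⇛ₕ-cons q (suc x) = ⇛ₕ-var

mutual
  ⇛ₕ-sub : ∀ {σ σ'} → (∀ x → σ x ⇛ₕ σ' x) → ∀ {t t'} → t ⇛ₕ t' → sub σ t ⇛ₕ sub σ' t'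
  ⇛ₕ-sub {σ} σ⇛ (head-then-internal r i) = ≻-⇛ₕ (≻-sub σ r) (⇛ᵢ-sub σ⇛ i)

  ⇛ᵢ-sub : ∀ {σ σ'} → (∀ x → σ x ⇛ₕ σ' x) → ∀ {t t'} → t ⇛ᵢ t' → sub σ t ⇛ₕ sub σ' t'
  ⇛ᵢ-sub σ⇛ (⇛ᵢ-lam i)   = ⇛ₕ-lam (⇛ᵢ-sub (⇛ₕ-liftS σ⇛) i)
  ⇛ᵢ-sub σ⇛ (⇛ᵢ-spine s) = ⇛ₛ-sub σ⇛ s

  ⇛ₛ-sub : ∀ {σ σ'} → (∀ x → σ x ⇛ₕ σ' x) → ∀ {t t'} → t ⇛ₛ t' → sub σ t ⇛ₕ sub σ' t'
  ⇛ₛ-sub σ⇛ ⇛ₛ-var         = σ⇛ _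
  ⇛ₛ-sub σ⇛ (⇛ₛ-app s w)   = ⇛ₕ-app (⇛ₛ-sub σ⇛ s) (⇛ₕ-sub σ⇛ w)
  ⇛ₛ-sub σ⇛ (⇛ₛ-redex u w) =
    head-then-internal ◅-refl (⇛ᵢ-spine (⇛ₛ-redex (⇛ₕ-sub (⇛ₕ-liftS σ⇛) u) (⇛ₕ-sub σ⇛ w)))

⇛⇒⇛ₕ : ∀ {t t'} → t ⇛ t' → t ⇛ₕ t'
⇛⇒⇛ₕ ⇛-var       = ⇛ₕ-var
⇛⇒⇛ₕ (⇛-lam p)   = ⇛ₕ-lam (⇛⇒⇛ₕ p)
⇛⇒⇛ₕ (⇛-app p q) = ⇛ₕ-app (⇛⇒⇛ₕ p) (⇛⇒⇛ₕ q)
⇛⇒⇛ₕ (⇛-β p q)   = ≻-⇛ₕ (h-β ◅ ◅-refl) (⇛ₕ-sub (⇛ₕ-cons (⇛⇒⇛ₕ q)) (⇛⇒⇛ₕ p))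

mutual
  ⇛ᵢ-→h-postpone : ∀ {t u u'} → t ⇛ᵢ u → u →h u' → ∃ λ t' → (t →h t') × (t' ⇛ₕ u')
  ⇛ᵢ-→h-postpone (⇛ᵢ-lam i) (h-lam p) with ⇛ᵢ-→h-postpone i p
  ... | _ , t→h , ⇛ₕu' = _ , h-lam t→h , ⇛ₕ-lam ⇛ₕu'
  ⇛ᵢ-→h-postpone (⇛ᵢ-spine s) p = ⇛ₛ-→h-postpone s p

  ⇛ₛ-→h-postpone : ∀ {t u u'} → t ⇛ₛ u → u →h u' → ∃ λ t' → (t →h t') × (t' ⇛ₕ u')
  ⇛ₛ-→h-postpone (⇛ₛ-redex u w) h-β = _ , h-β , ⇛ₕ-sub (⇛ₕ-cons w) u
  ⇛ₛ-→h-postpone (⇛ₛ-app () w) h-β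
  ⇛ₛ-→h-postpone (⇛ₛ-app s@(⇛ₛ-app _ _) w) (h-app p) with ⇛ₛ-→h-postpone s p
  ... | _ , t→h , ⇛ₕu' = _ , h-app t→h , ⇛ₕ-app ⇛ₕu' w
  ⇛ₛ-→h-postpone (⇛ₛ-app s@(⇛ₛ-redex _ _) w) (h-app p) with ⇛ₛ-→h-postpone s p
  ... | _ , t→h , ⇛ₕu' = _ , h-app t→h , ⇛ₕ-app ⇛ₕu' w

⇛ᵢ-≻-rigid : ∀ {e} → InternallyRigid e → ∀ {t u} → t ⇛ᵢ u → u ≻ e → t ≻ e
⇛ᵢ-≻-rigid e-rigid i ◅-refl with e-rigid i
... | refl = ◅-refl
⇛ᵢ-≻-rigid e-rigid i (p ◅ r) with ⇛ᵢ-→h-postpone i p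
... | _ , t→h , head-then-internal r' i' = t→h ◅ (r' ◅◅ ⇛ᵢ-≻-rigid e-rigid i' r)

⇛*-rigid⇒≻ : ∀ {e} → InternallyRigid e → ∀ {θ} → θ ⇛* e → θ ≻ e
⇛*-rigid⇒≻ e-rigid ◅-refl = ◅-refl
⇛*-rigid⇒≻ e-rigid (p ◅ r) with ⇛⇒⇛ₕ p
... | head-then-internal r' i = r' ◅◅ ⇛ᵢ-≻-rigid e-rigid i (⇛*-rigid⇒≻ e-rigid r)

≃β⇒≻ : ∀ {e θ} → ParNormal e → InternallyRigid e → θ ≃β e → θ ≻ e
≃β⇒≻ e-normal e-rigid θ≃e = ⇛*-rigid⇒≻ e-rigid (≃β⇒⇛* e-normal θ≃e)

λλvar-parNormal : ∀ k → ParNormal (lam (lam (var k)))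
λλvar-parNormal k (⇛-lam (⇛-lam ⇛-var)) = refl

λλvar-internallyRigid : ∀ k → InternallyRigid (lam (lam (var k)))
λλvar-internallyRigid k (⇛ᵢ-lam (⇛ᵢ-lam (⇛ᵢ-spine ⇛ₛ-var))) = refl
λλvar-internallyRigid k (⇛ᵢ-lam (⇛ᵢ-spine ()))
λλvar-internallyRigid k (⇛ᵢ-spine ())

≃β-λλvar⇒≻ : ∀ {k θ} → θ ≃β lam (lam (var k)) → θ ≻ lam (lam (var k))
≃β-λλvar⇒≻ {k} = ≃β⇒≻ (λλvar-parNormal k) (λλvar-internallyRigid k)

-- With de Bruijn indices no capture can occur, so the freshness of f is not needed.
O_B-head-reduces : (ε : Tm) → (ε ≡ T ⊎ ε ≡ F) → (θ : Tm) → θ ≃β ε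
  → (f : ℕ) → app (app O_B θ) (var f) ≻ app (var f) ε
O_B-head-reduces .T (inj₁ refl) θ θ≃T f =
  h-app h-β ◅ ≻-β (var f) (≻-β _ (≻-β _ (≃β-λλvar⇒≻ θ≃T)))
O_B-head-reduces .F (inj₂ refl) θ θ≃F f =
  h-app h-β ◅ ≻-β (var f) (≻-β _ (≻-β _ (≃β-λλvar⇒≻ θ≃F)))

⊢T : ∀ {Γ} → Γ ⊢ T ∶ Bool𝔽
⊢T = ⊢gen (⊢lam (⊢lam (⊢var (there here))))

⊢F : ∀ {Γ} → Γ ⊢ F ∶ Bool𝔽
⊢F = ⊢gen (⊢lam (⊢lam (⊢var here)))

⊢O_B : [] ⊢ O_B ∶ (Bool𝔽 * ⇒ ¬ᵗ (¬ᵗ Bool𝔽))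
⊢O_B = ⊢lam (⊢app (⊢app (⊢inst {B = ¬ᵗ Bool𝔽} (⊢var here))
                         (⊢lam (⊢app (⊢var here) ⊢T)))
                  (⊢lam (⊢app (⊢var here) ⊢F)))

mainTheorem6 : ([] ⊢ O_B ∶ ((Bool𝔽 *) ⇒ ¬ᵗ (¬ᵗ Bool𝔽)))
    × ((ε : Tm) → (ε ≡ T ⊎ ε ≡ F) → (θ : Tm) → θ ≃β ε
    → (f : ℕ) → ¬ (f ∈fv θ)
    → app (app O_B θ) (var f) ≻ app (var f) ε)
mainTheorem6 = ⊢O_B , λ ε ε∈TF θ θ≃ε f _ → O_B-head-reduces ε ε∈TF θ θ≃ε f
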